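{- Let $m,j\in\mathbb{N}$ with $m\geq 5$ and $1\leq j<\frac{m}{2}$. Then the generalized Petersen graph $G(m,j)$ admits a 3-balanced coloring if and only if $3\mid m$ and $3\nmid j$.
   Context: The generalized Petersen graph $G(m,j)$ has vertex set $\{v_i,u_i : i\in\mathbb{Z}_m\}$ and edges $v_iv_{i+1}$, $v_iu_i$, and $u_iu_{i+j}$ for $i\in\mathbb{Z}_m$. A coloring $\ell:V\to\mathbb{Z}_3$ of the vertices of a graph is 3-balanced if every vertex has, in its open neighborhood, the same number of vertices of each of the three colors. -}

module Defs where

open import Data.Nat using (ℕ; _+_; _%_; NonZero)
open import Data.Fin using (Fin; toℕ)
open import Data.Bool using (Bool; true; false)
open import Data.Product using (_×_; _,_)
open import Data.List using (List; length; filter; map; cartesianProduct)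
open import Data.List using (allFin)
open import Relation.Binary.PropositionalEquality using (_≡_)
open import Relation.Nullary using (Dec; yes; no)
open import Relation.Nullary.Decidable using (_⊎-dec_; _×-dec_)
open import Data.Sum using (_⊎_)
import Data.Nat as ℕ
import Data.Fin as F

-- Vertices of G(m,j): (false , i) is v_i (outer), (true , i) is u_i (inner).
Vertex : ℕ → Set
Vertex m = Bool × Fin m

_≡[_+_]mod : {m : ℕ} → Fin m → Fin m → ℕ → Set
_≡[_+_]mod {ℕ.suc n} a b k = toℕ a ≡ (toℕ b + k) % ℕ.suc n
_≡[_+_]mod {ℕ.zero} () b k

GPAdj : (m j : ℕ) → Vertex m → Vertex m → Set
GPAdj m j (false , a) (false , b) = (b ≡[ a + 1 ]mod) ⊎ (a ≡[ b + 1 ]mod)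
GPAdj m j (false , a) (true  , b) = a ≡ b
GPAdj m j (true  , a) (false , b) = a ≡ b
GPAdj m j (true  , a) (true  , b) = (b ≡[ a + j ]mod) ⊎ (a ≡[ b + j ]mod)

GPAdj? : (m j : ℕ) → (x y : Vertex m) → Dec (GPAdj m j x y)
GPAdj? (ℕ.suc n) j (false , a) (false , b) = (toℕ b ℕ.≟ _) ⊎-dec (toℕ a ℕ.≟ _)
GPAdj? m j (false , a) (true  , b) = a F.≟ b
GPAdj? m j (true  , a) (false , b) = a F.≟ b
GPAdj? (ℕ.suc n) j (true  , a) (true  , b) = (toℕ b ℕ.≟ _) ⊎-dec (toℕ a ℕ.≟ _)

allVertices : (m : ℕ) → List (Vertex m)
allVertices m = cartesianProduct (false Data.List.∷ true Data.List.∷ Data.List.[]) (allFin m)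

nbrCount : (m j : ℕ) → (Vertex m → Fin 3) → Vertex m → Fin 3 → ℕ
nbrCount m j ℓ x c =
  length (filter (λ y → GPAdj? m j x y ×-dec (ℓ y F.≟ c)) (allVertices m))

ThreeBalanced : (m j : ℕ) → (Vertex m → Fin 3) → Set
ThreeBalanced m j ℓ = ∀ x (c c' : Fin 3) → nbrCount m j ℓ x c ≡ nbrCount m j ℓ x c'

{-# OPTIONS --safe #-}
-- G(m,j) is cubic, so a colouring is 3-balanced exactly when every neighbourhood is rainbow
-- (three distinct colours).  If 3 ∣ m and 3 ∤ j, colouring v_i and u_i by i mod 3 works.
-- Conversely let C and D be the colour sequences of the outer and inner cycle: D (a+1) is the
-- colour missing from C a, C (a+2), and C (a+j) the colour missing from D a, D (a+2j).  Chasing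
-- these shows C a ≢ C (a+4), so C a, C (a+2), C (a+4) are rainbow and C has period 6; with
-- period m and C a ≢ C (a+2) this forces 3 ∣ m.  Then D (a+1) has period 6 as well, and 3 ∣ j
-- would give D 1 ≡ D (1+2j), two neighbours of u_(1+j).
module Submission where

open import Defs
open import Data.Nat using (ℕ; _≤_; _<_; _*_)
open import Data.Nat.Divisibility using (_∣_)
open import Data.Fin using (Fin)
open import Data.Product using (∃; _×_)
open import Function.Bundles using (_⇔_; mk⇔)
open import Relation.Nullary using (¬_)

open import Data.Bool using (Bool; true; false; not)
open import Data.Empty using (⊥-elim)
open import Data.Fin using (toℕ)
open import Data.Fin.Properties using (_≟_; all?; toℕ-injective; toℕ-fromℕ<; toℕ<n)
open import Data.List using (List; []; _∷_; length; filter)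
open import Data.List.Membership.Propositional using (_∈_)
open import Data.List.Membership.Propositional.Properties
  using (∈-filter⁺; ∈-filter⁻; ∈-length; ∈-cartesianProduct⁺; ∈-allFin)
open import Data.List.Properties using (filter-none)
open import Data.List.Relation.Unary.All as All using ([]; _∷_)
open import Data.List.Relation.Unary.Any using (here; there)
open import Data.List.Relation.Unary.Unique.Propositional using (Unique; []; _∷_)
open import Data.List.Relation.Unary.Unique.Propositional.Properties
  using (cartesianProduct⁺; allFin⁺)
open import Data.Nat using (zero; suc; _+_; _∸_; _%_; _/_; NonZero; s≤s; z≤n)
open import Data.Nat.DivMod
  using (_mod_; m≡m%n+[m/n]*n; m%n<n; m<n⇒m%n≡m; m%n%n≡m%n; %-distribˡ-+; [m+n]%n≡m%n;
         [m+kn]%n≡m%n; m∣n⇒o%n%m≡o%m)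
open import Data.Nat.Divisibility using (divides; m%n≡0⇒n∣m; ∣⇒≤; ∣m+n∣m⇒∣n; n∣m*n)
open import Data.Nat.Properties
  using (+-assoc; +-comm; +-identityʳ; *-distribˡ-+; ≤-trans; <⇒≤; m≤n+m; m≤m+n;
         m≤m*n; m∸n+n≡m; m+[n∸m]≡n)
open import Data.Product using (_,_; proj₁; proj₂)
open import Data.Sum using (_⊎_; inj₁; inj₂)
open import Function using (_∘_)
open import Relation.Binary.PropositionalEquality
  using (_≡_; _≢_; refl; sym; trans; cong; subst; subst₂; ≢-sym; module ≡-Reasoning)
open import Data.Nat.Tactic.RingSolver using (solve-∀)
open import Relation.Nullary.Decidable
  using (Dec; yes; no; ¬?; _×-dec_; _⊎-dec_; _→-dec_; from-yes)

open ≡-Reasoning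

Rainbow : Fin 3 → Fin 3 → Fin 3 → Set
Rainbow a b c = a ≢ b × a ≢ c × b ≢ c

Covers : Fin 3 → Fin 3 → Fin 3 → Set
Covers a b c = ∀ d → d ≡ a ⊎ d ≡ b ⊎ d ≡ c

rainbow? : ∀ a b c → Dec (Rainbow a b c)
rainbow? a b c = ¬? (a ≟ b) ×-dec ¬? (a ≟ c) ×-dec ¬? (b ≟ c)

covers? : ∀ a b c → Dec (Covers a b c)
covers? a b c = all? λ d → d ≟ a ⊎-dec d ≟ b ⊎-dec d ≟ c

rainbow⇒covers : ∀ a b c → Rainbow a b c → Covers a b c
rainbow⇒covers = from-yes (all? λ a → all? λ b → all? λ c → rainbow? a b c →-dec covers? a b c)

covers⇒rainbow : ∀ a b c → Covers a b c → Rainbow a b c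
covers⇒rainbow = from-yes (all? λ a → all? λ b → all? λ c → covers? a b c →-dec rainbow? a b c)

rainbow-unique : ∀ {a b x y} → Rainbow a b x → Rainbow a b y → x ≡ y
rainbow-unique {a} {b} {x} {y} rx (_ , a≢y , b≢y) with rainbow⇒covers a b x rx y
... | inj₁ y≡a = ⊥-elim (a≢y (sym y≡a))
... | inj₂ (inj₁ y≡b) = ⊥-elim (b≢y (sym y≡b))
... | inj₂ (inj₂ y≡x) = sym y≡x

rainbow-rotate : ∀ {a b c} → Rainbow a b c → Rainbow b c a
rainbow-rotate (a≢b , a≢c , b≢c) = b≢c , ≢-sym a≢b , ≢-sym a≢c

module _ {A : Set} {P : A → Set} (P? : ∀ x → Dec (P x)) where

  length-filter≡1 : ∀ {xs w} → Unique xs → w ∈ xs → P w → (∀ {y} → P y → y ≡ w) →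
                    length (filter P? xs) ≡ 1
  length-filter≡1 {x ∷ xs} (x∉xs ∷ _) (here refl) Pw only with P? x
  ... | yes _ =
    cong (suc ∘ length) (filter-none P? (All.map (λ x≢y Py → x≢y (sym (only Py))) x∉xs))
  ... | no ¬Pw = ⊥-elim (¬Pw Pw)
  length-filter≡1 {x ∷ xs} (x∉xs ∷ xs-unique) (there w∈xs) Pw only with P? x
  ... | yes Px = ⊥-elim (All.lookup x∉xs w∈xs (only Px))
  ... | no _ = length-filter≡1 xs-unique w∈xs Pw only

nonempty-member : ∀ {A : Set} {xs : List A} → 0 < length xs → ∃ (_∈ xs)
nonempty-member {xs = x ∷ _} _ = x , here refl

module NeighbourColours {V : Set} (Adj : V → V → Set) (Adj? : ∀ x y → Dec (Adj x y))
                        {vs : List V} (vs-unique : Unique vs) (vs-complete : ∀ y → y ∈ vs) where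

  neighbour-coloured? : (ℓ : V → Fin 3) (x : V) (c : Fin 3) → ∀ y → Dec (Adj x y × ℓ y ≡ c)
  neighbour-coloured? ℓ x c y = Adj? x y ×-dec ℓ y ≟ c

  count : (V → Fin 3) → V → Fin 3 → ℕ
  count ℓ x c = length (filter (neighbour-coloured? ℓ x c) vs)

  BalancedAt : (V → Fin 3) → V → Set
  BalancedAt ℓ x = ∀ c c' → count ℓ x c ≡ count ℓ x c'

  record Neighbourhood (x y₁ y₂ y₃ : V) : Set where
    field
      adj₁ : Adj x y₁
      adj₂ : Adj x y₂
      adj₃ : Adj x y₃
      exhaustive : ∀ {y} → Adj x y → y ≡ y₁ ⊎ y ≡ y₂ ⊎ y ≡ y₃

  module _ {x y₁ y₂ y₃} (N : Neighbourhood x y₁ y₂ y₃) (ℓ : V → Fin 3) where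
    open Neighbourhood N

    count-pos⇒covered : ∀ c → 0 < count ℓ x c → c ≡ ℓ y₁ ⊎ c ≡ ℓ y₂ ⊎ c ≡ ℓ y₃
    count-pos⇒covered c pos
      with y , y∈ ← nonempty-member {xs = filter (neighbour-coloured? ℓ x c) vs} pos
      with _ , adj , refl ← ∈-filter⁻ (neighbour-coloured? ℓ x c) {xs = vs} y∈
      with exhaustive adj
    ... | inj₁ refl = inj₁ refl
    ... | inj₂ (inj₁ refl) = inj₂ (inj₁ refl)
    ... | inj₂ (inj₂ refl) = inj₂ (inj₂ refl)

    balanced⇒rainbow : BalancedAt ℓ x → Rainbow (ℓ y₁) (ℓ y₂) (ℓ y₃)
    balanced⇒rainbow balanced = covers⇒rainbow _ _ _ λ c →
      count-pos⇒covered c (subst (0 <_) (balanced (ℓ y₁) c)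
        (∈-length (∈-filter⁺ (neighbour-coloured? ℓ x (ℓ y₁)) (vs-complete y₁) (adj₁ , refl))))

    rainbow-injective : Rainbow (ℓ y₁) (ℓ y₂) (ℓ y₃) →
                        ∀ {y y'} → Adj x y → Adj x y' → ℓ y ≡ ℓ y' → y ≡ y'
    rainbow-injective (d₁₂ , d₁₃ , d₂₃) a a' e with exhaustive a | exhaustive a'
    ... | inj₁ refl         | inj₁ refl         = refl
    ... | inj₁ refl         | inj₂ (inj₁ refl)  = ⊥-elim (d₁₂ e)
    ... | inj₁ refl         | inj₂ (inj₂ refl)  = ⊥-elim (d₁₃ e)
    ... | inj₂ (inj₁ refl)  | inj₁ refl         = ⊥-elim (d₁₂ (sym e))
    ... | inj₂ (inj₁ refl)  | inj₂ (inj₁ refl)  = refl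
    ... | inj₂ (inj₁ refl)  | inj₂ (inj₂ refl)  = ⊥-elim (d₂₃ e)
    ... | inj₂ (inj₂ refl)  | inj₁ refl         = ⊥-elim (d₁₃ (sym e))
    ... | inj₂ (inj₂ refl)  | inj₂ (inj₁ refl)  = ⊥-elim (d₂₃ (sym e))
    ... | inj₂ (inj₂ refl)  | inj₂ (inj₂ refl)  = refl

    rainbow⇒count≡1 : Rainbow (ℓ y₁) (ℓ y₂) (ℓ y₃) → ∀ {w} → Adj x w → count ℓ x (ℓ w) ≡ 1
    rainbow⇒count≡1 r {w} adj =
      length-filter≡1 (neighbour-coloured? ℓ x (ℓ w)) vs-unique (vs-complete w) (adj , refl)
        λ (adj' , e) → rainbow-injective r adj' adj e

    rainbow⇒balanced : Rainbow (ℓ y₁) (ℓ y₂) (ℓ y₃) → BalancedAt ℓ x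
    rainbow⇒balanced r c c' = trans (count≡1 c) (sym (count≡1 c'))
      where
      count≡1 : ∀ c → count ℓ x c ≡ 1
      count≡1 c with rainbow⇒covers _ _ _ r c
      ... | inj₁ refl = rainbow⇒count≡1 r adj₁
      ... | inj₂ (inj₁ refl) = rainbow⇒count≡1 r adj₂
      ... | inj₂ (inj₂ refl) = rainbow⇒count≡1 r adj₃

%-+-congʳ : ∀ a b e d .{{_ : NonZero d}} → a % d ≡ b % d → (a + e) % d ≡ (b + e) % d
%-+-congʳ a b e d a≡b = begin
  (a + e) % d          ≡⟨ %-distribˡ-+ a e d ⟩
  (a % d + e % d) % d  ≡⟨ cong (λ z → (z + e % d) % d) a≡b ⟩
  (b % d + e % d) % d  ≡⟨ %-distribˡ-+ b e d ⟨
  (b + e) % d          ∎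

%-+-cancelʳ : ∀ a b k d .{{_ : NonZero d}} → (a + k) % d ≡ (b + k) % d → a % d ≡ b % d
%-+-cancelʳ a b k d eq =
  trans (undo a) (trans (%-+-congʳ (a + k) (b + k) (k * d ∸ k) d eq) (sym (undo b)))
  where
  -- k * d ∸ k is an additive inverse of k modulo d
  undo : ∀ z → z % d ≡ (z + k + (k * d ∸ k)) % d
  undo z = begin
    z % d                       ≡⟨ [m+kn]%n≡m%n z k d ⟨
    (z + k * d) % d             ≡⟨ cong (λ w → (z + w) % d) (m+[n∸m]≡n (m≤m*n k d)) ⟨
    (z + (k + (k * d ∸ k))) % d ≡⟨ cong (_% d) (+-assoc z k (k * d ∸ k)) ⟨
    (z + k + (k * d ∸ k)) % d   ∎

3∤1 : ¬ 3 ∣ 1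
3∤1 3∣1 with ∣⇒≤ 3∣1
... | s≤s ()

3∤k⇒3∤k+k : ∀ {k} → ¬ 3 ∣ k → ¬ 3 ∣ (k + k)
3∤k⇒3∤k+k {k} 3∤k 3∣k+k = 3∤k (∣m+n∣m⇒∣n (subst (3 ∣_) (sym (k+k+k≡k*3 k)) (n∣m*n k)) 3∣k+k)
  where
  k+k+k≡k*3 : ∀ n → n + n + n ≡ n * 3
  k+k+k≡k*3 = solve-∀

mod-3-apart : ∀ {t} → ¬ 3 ∣ t → ∀ x → x mod 3 ≢ (x + t) mod 3
mod-3-apart {t} 3∤t x e = 3∤t (m%n≡0⇒n∣m t 3 (sym (%-+-cancelʳ 0 t x 3 (begin
  x % 3                ≡⟨ toℕ-fromℕ< (m%n<n x 3) ⟨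
  toℕ (x mod 3)        ≡⟨ cong toℕ e ⟩
  toℕ ((x + t) mod 3)  ≡⟨ toℕ-fromℕ< (m%n<n (x + t) 3) ⟩
  (x + t) % 3          ≡⟨ cong (_% 3) (+-comm x t) ⟩
  (t + x) % 3          ∎))))

mod-3-rainbow : ∀ {k} → ¬ 3 ∣ k → ∀ x → Rainbow (x mod 3) ((x + k + k) mod 3) ((x + k) mod 3)
mod-3-rainbow {k} 3∤k x =
  subst (λ i → x mod 3 ≢ i mod 3) (sym (+-assoc x k k)) (mod-3-apart (3∤k⇒3∤k+k 3∤k) x) ,
  mod-3-apart 3∤k x ,
  ≢-sym (mod-3-apart 3∤k (x + k))

Periodic : {A : Set} → (ℕ → A) → ℕ → Set
Periodic f p = ∀ k → f (k + p) ≡ f k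

module _ {A : Set} {f : ℕ → A} where

  periodic-* : ∀ {p} → Periodic f p → ∀ t → Periodic f (t * p)
  periodic-* per zero k = cong f (+-identityʳ k)
  periodic-* {p} per (suc t) k = begin
    f (k + (p + t * p))  ≡⟨ cong f (+-assoc k p (t * p)) ⟨
    f (k + p + t * p)    ≡⟨ periodic-* per t (k + p) ⟩
    f (k + p)            ≡⟨ per k ⟩
    f k                  ∎

  periodic-% : ∀ {p q} .{{_ : NonZero q}} → Periodic f p → Periodic f q → Periodic f (p % q)
  periodic-% {p} {q} p-per q-per k = begin
    f (k + p % q)                ≡⟨ periodic-* q-per (p / q) (k + p % q) ⟨
    f (k + p % q + p / q * q)    ≡⟨ cong f (+-assoc k (p % q) (p / q * q)) ⟩
    f (k + (p % q + p / q * q))  ≡⟨ cong (f ∘ (k +_)) (m≡m%n+[m/n]*n p q) ⟨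
    f (k + p)                    ≡⟨ p-per k ⟩
    f k                          ∎

-- C k and D k stand for the colours of v_k and u_k; outer a and inner a say that the
-- neighbourhoods of v_(a+1) and u_(a+j) are rainbow.  Constants are added on the left and j on
-- the right so that the index arithmetic below holds by computation.
module ColourSequences {m j : ℕ} (2j≤m : j + j ≤ m) {C D : ℕ → Fin 3} (C-periodic : Periodic C m)
  (outer : ∀ a → Rainbow (C a) (C (2 + a)) (D (1 + a)))
  (inner : ∀ a → Rainbow (D a) (D (a + j + j)) (C (a + j))) where

  D-forced : ∀ a {δ} → C a ≢ δ → C (2 + a) ≢ δ → D (1 + a) ≡ δ
  D-forced a Ca≢δ C2a≢δ = rainbow-unique (outer a) (proj₁ (outer a) , Ca≢δ , C2a≢δ)

  -- If C a ≡ C (a + 4) then δ = D (a + 1) = D (a + 3) is forced on both inner neighbours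
  -- u_(a+2-j) and u_(a+2+j) of u_(a+2).
  C-4-apart-beyond-2j : ∀ b → C (b + j + j) ≢ C (4 + (b + j + j))
  C-4-apart-beyond-2j b e = proj₁ (inner (2 + (b + j))) (trans D-left (sym D-right))
    where
    a = b + j + j
    δ = D (1 + a)
    D3 : D (3 + a) ≡ δ
    D3 = D-forced (2 + a) (proj₂ (proj₂ (outer a))) (λ q → proj₁ (proj₂ (outer a)) (trans e q))
    D-left : D (2 + (b + j)) ≡ δ
    D-left = D-forced (1 + (b + j)) (≢-sym (proj₂ (proj₂ (inner (1 + b)))))
      (λ q → proj₂ (proj₂ (inner (3 + b))) (trans D3 (sym q)))
    D-right : D (2 + (a + j)) ≡ δ
    D-right = D-forced (1 + (a + j)) (≢-sym (proj₁ (proj₂ (inner (1 + a)))))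
      (λ q → proj₁ (proj₂ (inner (3 + a))) (trans D3 (sym q)))

  C-4-apart : ∀ k → C k ≢ C (4 + k)
  C-4-apart k e = C-4-apart-beyond-2j b (begin
    C (b + j + j)        ≡⟨ cong C b+2j≡k+m ⟩
    C (k + m)            ≡⟨ C-periodic k ⟩
    C k                  ≡⟨ e ⟩
    C (4 + k)            ≡⟨ C-periodic (4 + k) ⟨
    C (4 + (k + m))      ≡⟨ cong (C ∘ (4 +_)) b+2j≡k+m ⟨
    C (4 + (b + j + j))  ∎)
    where
    b = k + m ∸ (j + j)
    b+2j≡k+m : b + j + j ≡ k + m
    b+2j≡k+m = trans (+-assoc b j j) (m∸n+n≡m (≤-trans 2j≤m (m≤n+m m k)))

  C-rainbow : ∀ k → Rainbow (C k) (C (2 + k)) (C (4 + k))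
  C-rainbow k = proj₁ (outer k) , C-4-apart k , proj₁ (outer (2 + k))

  C-6-periodic : Periodic C 6
  C-6-periodic k =
    trans (cong C (+-comm k 6)) (rainbow-unique (C-rainbow (2 + k)) (rainbow-rotate (C-rainbow k)))

  ¬1-periodic : ¬ Periodic C 1
  ¬1-periodic per = proj₁ (outer 0) (sym (trans (per 1) (per 0)))

  ¬2-periodic : ¬ Periodic C 2
  ¬2-periodic per = proj₁ (outer 0) (sym (per 0))

  period<6⇒period%3≡0 : ∀ r → r < 6 → Periodic C r → r % 3 ≡ 0
  period<6⇒period%3≡0 0 _ _ = refl
  period<6⇒period%3≡0 1 _ per = ⊥-elim (¬1-periodic per)
  period<6⇒period%3≡0 2 _ per = ⊥-elim (¬2-periodic per)
  period<6⇒period%3≡0 3 _ _ = refl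
  period<6⇒period%3≡0 4 _ per = ⊥-elim (¬2-periodic (periodic-% C-6-periodic per))
  period<6⇒period%3≡0 5 _ per = ⊥-elim (¬1-periodic (periodic-% C-6-periodic per))
  period<6⇒period%3≡0 (suc (suc (suc (suc (suc (suc _))))))
                      (s≤s (s≤s (s≤s (s≤s (s≤s (s≤s ())))))) _

  3∣m : 3 ∣ m
  3∣m = m%n≡0⇒n∣m m 3 (begin
    m % 3      ≡⟨ m∣n⇒o%n%m≡o%m 3 6 m (divides 2 refl) ⟨
    m % 6 % 3  ≡⟨ period<6⇒period%3≡0 (m % 6) (m%n<n m 6) (periodic-% C-periodic C-6-periodic) ⟩
    0          ∎)

  D-6-periodic : Periodic (D ∘ suc) 6
  D-6-periodic k = D-forced (k + 6)
    (λ q → proj₁ (proj₂ (outer k)) (trans (sym (C-6-periodic k)) q))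
    (λ q → proj₂ (proj₂ (outer k)) (trans (sym (C-6-periodic (2 + k))) q))

  3∤j : ¬ 3 ∣ j
  3∤j (divides t j≡t*3) = proj₁ (inner 1) (sym (begin
    D (1 + j + j)            ≡⟨ cong (λ i → D (1 + i + i)) j≡t*3 ⟩
    D (1 + (t * 3 + t * 3))  ≡⟨ cong (D ∘ suc) (*-distribˡ-+ t 3 3) ⟨
    D (suc (0 + t * 6))      ≡⟨ periodic-* D-6-periodic t 0 ⟩
    D 1                      ∎))

allVertices-unique : ∀ m → Unique (allVertices m)
allVertices-unique m = cartesianProduct⁺ (((λ ()) ∷ []) ∷ [] ∷ []) (allFin⁺ m)

allVertices-complete : ∀ {m} (y : Vertex m) → y ∈ allVertices m
allVertices-complete (b , i) = ∈-cartesianProduct⁺ (bool∈ b) (∈-allFin i)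
  where
  bool∈ : ∀ b → b ∈ false ∷ true ∷ []
  bool∈ false = here refl
  bool∈ true = there (here refl)

module GeneralizedPetersen (n j : ℕ) (2j≤m : j + j ≤ suc n) where

  -- m is written as suc n so that _≡[_+_]mod computes
  m : ℕ
  m = suc n

  open NeighbourColours (GPAdj m j) (GPAdj? m j) (allVertices-unique m) allVertices-complete

  ⌊_⌋ : ℕ → Fin m
  ⌊ k ⌋ = k mod m

  toℕ-⌊⌋ : ∀ k → toℕ ⌊ k ⌋ ≡ k % m
  toℕ-⌊⌋ k = toℕ-fromℕ< (m%n<n k m)

  ⌊toℕ⌋ : ∀ i → ⌊ toℕ i ⌋ ≡ i
  ⌊toℕ⌋ i = toℕ-injective (trans (toℕ-⌊⌋ (toℕ i)) (m<n⇒m%n≡m (toℕ<n i)))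

  ⌊+m⌋ : ∀ k → ⌊ k + m ⌋ ≡ ⌊ k ⌋
  ⌊+m⌋ k = toℕ-injective (trans (toℕ-⌊⌋ (k + m)) (trans ([m+n]%n≡m%n k m) (sym (toℕ-⌊⌋ k))))

  ⌊+⌋≡[⌊⌋+]mod : ∀ x k → ⌊ x + k ⌋ ≡[ ⌊ x ⌋ + k ]mod
  ⌊+⌋≡[⌊⌋+]mod x k = trans (toℕ-⌊⌋ (x + k)) (%-+-congʳ x (toℕ ⌊ x ⌋) k m (begin
    x % m            ≡⟨ m%n%n≡m%n x m ⟨
    x % m % m        ≡⟨ cong (_% m) (toℕ-⌊⌋ x) ⟨
    toℕ ⌊ x ⌋ % m    ∎))

  ≡[+]mod-functional : ∀ {a b b' : Fin m} {k} → b ≡[ a + k ]mod → b' ≡[ a + k ]mod → b ≡ b'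
  ≡[+]mod-functional e e' = toℕ-injective (trans e (sym e'))

  ≡[+]mod-injective : ∀ {a a' b : Fin m} {k} → b ≡[ a + k ]mod → b ≡[ a' + k ]mod → a ≡ a'
  ≡[+]mod-injective {a} {a'} {k = k} e e' = toℕ-injective (begin
    toℕ a      ≡⟨ m<n⇒m%n≡m (toℕ<n a) ⟨
    toℕ a % m  ≡⟨ %-+-cancelʳ (toℕ a) (toℕ a') k m (trans (sym e) e') ⟩
    toℕ a' % m ≡⟨ m<n⇒m%n≡m (toℕ<n a') ⟩
    toℕ a'     ∎)

  cycle-exhaustive : ∀ x k {b} → b ≡[ ⌊ x + k ⌋ + k ]mod ⊎ ⌊ x + k ⌋ ≡[ b + k ]mod →
                     b ≡ ⌊ x ⌋ ⊎ b ≡ ⌊ x + k + k ⌋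
  cycle-exhaustive x k (inj₁ e) =
    inj₂ (≡[+]mod-functional {a = ⌊ x + k ⌋} e (⌊+⌋≡[⌊⌋+]mod (x + k) k))
  cycle-exhaustive x k (inj₂ e) = inj₁ (≡[+]mod-injective e (⌊+⌋≡[⌊⌋+]mod x k))

  step : Bool → ℕ
  step false = 1
  step true = j

  same-cycle : ∀ {s} {b b₁ b₂ : Fin m} {y₃ : Vertex m} → b ≡ b₁ ⊎ b ≡ b₂ →
               (s , b) ≡ (s , b₁) ⊎ (s , b) ≡ (s , b₂) ⊎ (s , b) ≡ y₃
  same-cycle (inj₁ refl) = inj₁ refl
  same-cycle (inj₂ refl) = inj₂ (inj₁ refl)

  neighbourhood : ∀ s x → Neighbourhood (s , ⌊ x + step s ⌋)
                    (s , ⌊ x ⌋) (s , ⌊ x + step s + step s ⌋) (not s , ⌊ x + step s ⌋)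
  neighbourhood false x = record
    { adj₁ = inj₂ (⌊+⌋≡[⌊⌋+]mod x 1)
    ; adj₂ = inj₁ (⌊+⌋≡[⌊⌋+]mod (x + 1) 1)
    ; adj₃ = refl
    ; exhaustive = λ { {false , _} adj → same-cycle (cycle-exhaustive x 1 adj)
                     ; {true , _} refl → inj₂ (inj₂ refl) }
    }
  neighbourhood true x = record
    { adj₁ = inj₂ (⌊+⌋≡[⌊⌋+]mod x j)
    ; adj₂ = inj₁ (⌊+⌋≡[⌊⌋+]mod (x + j) j)
    ; adj₃ = refl
    ; exhaustive = λ { {true , _} adj → same-cycle (cycle-exhaustive x j adj)
                     ; {false , _} refl → inj₂ (inj₂ refl) }
    }

  step≤m : ∀ s → step s ≤ m
  step≤m false = s≤s z≤n
  step≤m true = ≤-trans (m≤m+n j j) 2j≤m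

  balancedAt-centres⇒balanced : ∀ ℓ → (∀ s x → BalancedAt ℓ (s , ⌊ x + step s ⌋)) →
                                ThreeBalanced m j ℓ
  balancedAt-centres⇒balanced ℓ balanced (s , i) =
    subst (λ i → BalancedAt ℓ (s , i)) centre (balanced s x)
    where
    x = toℕ i + m ∸ step s
    centre : ⌊ x + step s ⌋ ≡ i
    centre = trans (cong ⌊_⌋ (m∸n+n≡m (≤-trans (step≤m s) (m≤n+m m (toℕ i)))))
                   (trans (⌊+m⌋ (toℕ i)) (⌊toℕ⌋ i))

  residue : Vertex m → Fin 3
  residue (_ , i) = toℕ i mod 3

  residue-balanced : 3 ∣ m → ¬ 3 ∣ j → ThreeBalanced m j residue
  residue-balanced 3∣m 3∤j = balancedAt-centres⇒balanced residue λ s x →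
    rainbow⇒balanced (neighbourhood s x) residue (residue-rainbow s x)
    where
    residue-⌊⌋ : ∀ x → toℕ ⌊ x ⌋ mod 3 ≡ x mod 3
    residue-⌊⌋ x = toℕ-injective (begin
      toℕ (toℕ ⌊ x ⌋ mod 3)  ≡⟨ toℕ-fromℕ< (m%n<n (toℕ ⌊ x ⌋) 3) ⟩
      toℕ ⌊ x ⌋ % 3          ≡⟨ cong (_% 3) (toℕ-⌊⌋ x) ⟩
      x % m % 3              ≡⟨ m∣n⇒o%n%m≡o%m 3 m x 3∣m ⟩
      x % 3                  ≡⟨ toℕ-fromℕ< (m%n<n x 3) ⟨
      toℕ (x mod 3)          ∎)
    3∤step : ∀ s → ¬ 3 ∣ step s
    3∤step false = 3∤1
    3∤step true = 3∤j
    residue-rainbow : ∀ s x → Rainbow (residue (s , ⌊ x ⌋))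
                                      (residue (s , ⌊ x + step s + step s ⌋))
                                      (residue (not s , ⌊ x + step s ⌋))
    residue-rainbow s x
      rewrite residue-⌊⌋ x | residue-⌊⌋ (x + step s + step s) | residue-⌊⌋ (x + step s)
      = mod-3-rainbow (3∤step s) x

  module _ {ℓ : Vertex m → Fin 3} (balanced : ThreeBalanced m j ℓ) where

    private
      C D : ℕ → Fin 3
      C k = ℓ (false , ⌊ k ⌋)
      D k = ℓ (true , ⌊ k ⌋)

      outer-rainbow : ∀ a → Rainbow (C a) (C (2 + a)) (D (1 + a))
      outer-rainbow a = subst₂ (λ i i' → Rainbow (C a) (C i') (D i))
        (+-comm a 1) (trans (+-assoc a 1 1) (+-comm a 2))
        (balanced⇒rainbow (neighbourhood false a) ℓ (balanced (false , ⌊ a + 1 ⌋)))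

      inner-rainbow : ∀ a → Rainbow (D a) (D (a + j + j)) (C (a + j))
      inner-rainbow a = balanced⇒rainbow (neighbourhood true a) ℓ (balanced (true , ⌊ a + j ⌋))

      open ColourSequences 2j≤m (cong (λ i → ℓ (false , i)) ∘ ⌊+m⌋) outer-rainbow inner-rainbow

    balanced⇒3∣m : 3 ∣ m
    balanced⇒3∣m = 3∣m

    balanced⇒3∤j : ¬ 3 ∣ j
    balanced⇒3∤j = 3∤j

  balanced-colouring⇔ : (∃ λ ℓ → ThreeBalanced m j ℓ) ⇔ (3 ∣ m × ¬ 3 ∣ j)
  balanced-colouring⇔ = mk⇔ (λ (_ , balanced) → balanced⇒3∣m balanced , balanced⇒3∤j balanced)
                            (λ (3∣m , 3∤j) → residue , residue-balanced 3∣m 3∤j)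

theorem4p2 : (m j : ℕ) → 5 ≤ m → 1 ≤ j → 2 * j < m →
    ((∃ λ (ℓ : Vertex m → Fin 3) → ThreeBalanced m j ℓ) ⇔ ((3 ∣ m) × ¬ (3 ∣ j)))
theorem4p2 zero j () _ _
theorem4p2 (suc n) j _ _ 2j<m = GeneralizedPetersen.balanced-colouring⇔ n j
  (subst (_≤ suc n) (cong (j +_) (+-identityʳ j)) (<⇒≤ 2j<m))
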